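{- Let $G$ be a graph and let $\mathrm{cl}(G)$ be its clone. Then $\chi_{td}(\mathrm{cl}(G)) \leq 2\chi_{td}(G)+1$.
   Context: For a graph $G$ and a positive integer $k$, a proper $k$-total difference labeling of $G$ is a function $f$ from $V(G)\cup E(G)$ to $\{1,2,\dots,k\}$ such that: (1) for every edge $\{u,v\}$, $f(\{u,v\})=|f(u)-f(v)|$; (2) adjacent vertices receive different labels; (3) two edges sharing a vertex receive different labels; (4) no edge receives the same label as one of its endpoints. $\chi_{td}(G)$ denotes the smallest $k$ for which $G$ has a proper $k$-total difference labeling. The clone $\mathrm{cl}(G)$ of a graph $G$ with vertices $g_1,g_2,\dots$ is the Cartesian product $G\square K_2$: it has vertices $x_1,x_2,\dots$ and $y_1,y_2,\dots$, where $x_i$ is adjacent to $x_j$ iff $g_i$ is adjacent to $g_j$, $y_i$ is adjacent to $y_j$ iff $g_i$ is adjacent to $g_j$, and $x_i$ is adjacent to $y_j$ iff $i=j$. -}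

module Defs where

open import Level using (0ℓ)
open import Data.Nat using (ℕ; suc; _+_; _*_; _≤_; _<_; ∣_-_∣)
open import Data.Fin using (Fin; splitAt)
open import Data.Sum using (_⊎_; inj₁; inj₂)
open import Data.Product using (_×_; Σ)
open import Data.Empty using (⊥)
open import Relation.Nullary using (¬_)
open import Relation.Binary.PropositionalEquality using (_≡_; _≢_)

record Graph : Set₁ where
  field
    n     : ℕ
    Adj   : Fin n → Fin n → Set
    sym   : ∀ {u v} → Adj u v → Adj v u
    irrefl : ∀ {u} → ¬ Adj u u
open Graph public

-- Proper k-total difference labeling.  The vertex labels f determine the
-- edge labels: the edge {u,v} gets |f u - f v|.
record ProperTDL (G : Graph) (k : ℕ) : Set where
  field
    f          : Fin (n G) → ℕ
    vlabel-range : ∀ v → 1 ≤ f v × f v ≤ k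
    elabel-range : ∀ u v → Adj G u v → 1 ≤ ∣ f u - f v ∣ × ∣ f u - f v ∣ ≤ k
    adj-distinct : ∀ u v → Adj G u v → f u ≢ f v
    edge-distinct : ∀ u v w → Adj G u v → Adj G u w → v ≢ w →
                    ∣ f u - f v ∣ ≢ ∣ f u - f w ∣
    -- (4) no edge receives the label of one of its endpoints
    --     (u ranges over both endpoints since Adj is symmetric)
    edge-endpoint : ∀ u v → Adj G u v → ∣ f u - f v ∣ ≢ f u

IsChiTd : Graph → ℕ → Set
IsChiTd G k = 1 ≤ k × ProperTDL G k × (∀ j → 1 ≤ j → j < k → ¬ ProperTDL G j)

-- Clone cl(G) = G □ K₂ on Fin (n + n): the first copy (x_i) and second copy (y_i).
CloneAdj : (G : Graph) → Fin (n G) ⊎ Fin (n G) → Fin (n G) ⊎ Fin (n G) → Set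
CloneAdj G (inj₁ i) (inj₁ j) = Adj G i j
CloneAdj G (inj₂ i) (inj₂ j) = Adj G i j
CloneAdj G (inj₁ i) (inj₂ j) = i ≡ j
CloneAdj G (inj₂ i) (inj₁ j) = i ≡ j

private
  cloneSym : (G : Graph) → ∀ a b → CloneAdj G a b → CloneAdj G b a
  cloneSym G (inj₁ i) (inj₁ j) p = sym G p
  cloneSym G (inj₂ i) (inj₂ j) p = sym G p
  cloneSym G (inj₁ i) (inj₂ j) p = Relation.Binary.PropositionalEquality.sym p
  cloneSym G (inj₂ i) (inj₁ j) p = Relation.Binary.PropositionalEquality.sym p

  cloneIrr : (G : Graph) → ∀ a → ¬ CloneAdj G a a
  cloneIrr G (inj₁ i) p = irrefl G p
  cloneIrr G (inj₂ i) p = irrefl G p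

clone : Graph → Graph
clone G = record
  { n = n G + n G
  ; Adj = λ a b → CloneAdj G (splitAt (n G) a) (splitAt (n G) b)
  ; sym = λ {a} {b} → cloneSym G (splitAt (n G) a) (splitAt (n G) b)
  ; irrefl = λ {a} → cloneIrr G (splitAt (n G) a)
  }

module Submission where

open import Defs hiding (sym)
open import Data.Nat using (ℕ; zero; suc; _+_; _*_; _≤_; ∣_-_∣; s≤s; z≤n; _≤?_)
open import Data.Nat.Properties
open import Data.Fin using (Fin; splitAt; join)
open import Data.Fin.Properties using (join-splitAt)
open import Data.Sum using (_⊎_; inj₁; inj₂)
open import Data.Product using (_×_; _,_; proj₁; proj₂)
open import Relation.Nullary using (yes; no; contradiction)
open import Relation.Binary.PropositionalEquality

-- Double a proper k-labelling f of G and put 2 f(i) on x_i and 2 f(i) + 1 on y_i.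
-- Edges inside a copy get the even labels 2 |f(i) - f(j)|, rungs x_i y_i get 1,
-- while x-vertices are even and y-vertices odd, so every condition for cl(G)
-- either halves to the same condition for G or is a parity clash
-- (a rung at y_i clashing with its endpoint would force f(i) = 0).

∣2m-2n∣≡2∣m-n∣ : ∀ m n → ∣ 2 * m - 2 * n ∣ ≡ 2 * ∣ m - n ∣
∣2m-2n∣≡2∣m-n∣ m n = sym (*-distribˡ-∣-∣ 2 m n)

∣2m-2n∣≢1 : ∀ m n → ∣ 2 * m - 2 * n ∣ ≢ 1
∣2m-2n∣≢1 m n eq = even≢odd ∣ m - n ∣ 0 (trans (sym (∣2m-2n∣≡2∣m-n∣ m n)) eq)

∣2m-2n∣≡∣2m-2o∣⇒∣m-n∣≡∣m-o∣ : ∀ m n o → ∣ 2 * m - 2 * n ∣ ≡ ∣ 2 * m - 2 * o ∣ →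
                              ∣ m - n ∣ ≡ ∣ m - o ∣
∣2m-2n∣≡∣2m-2o∣⇒∣m-n∣≡∣m-o∣ m n o eq = *-cancelˡ-≡ ∣ m - n ∣ ∣ m - o ∣ 2 (begin
  2 * ∣ m - n ∣     ≡⟨ ∣2m-2n∣≡2∣m-n∣ m n ⟨
  ∣ 2 * m - 2 * n ∣ ≡⟨ eq ⟩
  ∣ 2 * m - 2 * o ∣ ≡⟨ ∣2m-2n∣≡2∣m-n∣ m o ⟩
  2 * ∣ m - o ∣     ∎)
  where open ≡-Reasoning

∣n-1+n∣≡1 : ∀ n → ∣ n - suc n ∣ ≡ 1
∣n-1+n∣≡1 zero    = refl
∣n-1+n∣≡1 (suc n) = ∣n-1+n∣≡1 n

∣1+n-n∣≡1 : ∀ n → ∣ suc n - n ∣ ≡ 1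
∣1+n-n∣≡1 n = trans (∣-∣-comm (suc n) n) (∣n-1+n∣≡1 n)

2*-bounds : ∀ {a k} → 1 ≤ a → a ≤ k → 1 ≤ 2 * a × 2 * a ≤ 2 * k + 1
2*-bounds {a} {k} 1≤a a≤k =
  ≤-trans (s≤s z≤n) (*-monoʳ-≤ 2 1≤a) , ≤-trans (*-monoʳ-≤ 2 a≤k) (m≤m+n (2 * k) 1)

1+2*-bounds : ∀ {a k} → a ≤ k → 1 ≤ suc (2 * a) × suc (2 * a) ≤ 2 * k + 1
1+2*-bounds {a} {k} a≤k =
  s≤s z≤n , subst (suc (2 * a) ≤_) (+-comm 1 (2 * k)) (s≤s (*-monoʳ-≤ 2 a≤k))

splitAt-injective : ∀ m {n} {i j : Fin (m + n)} → splitAt m i ≡ splitAt m j → i ≡ j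
splitAt-injective m {n} {i} {j} eq = begin
  i                      ≡⟨ join-splitAt m n i ⟨
  join m n (splitAt m i) ≡⟨ cong (join m n) eq ⟩
  join m n (splitAt m j) ≡⟨ join-splitAt m n j ⟩
  j                      ∎
  where open ≡-Reasoning

IsChiTd⇒≤ : ∀ {G k j} → IsChiTd G k → 1 ≤ j → ProperTDL G j → k ≤ j
IsChiTd⇒≤ {k = k} {j} (_ , _ , minimal) 1≤j P with k ≤? j
... | yes k≤j = k≤j
... | no  k≰j = contradiction P (minimal j 1≤j (≰⇒> k≰j))

module CloneLabelling (G : Graph) (k : ℕ) (P : ProperTDL G k) where
  open ProperTDL P

  V : Set
  V = Fin (n G) ⊎ Fin (n G)

  g : V → ℕ
  g (inj₁ i) = 2 * f i
  g (inj₂ i) = suc (2 * f i)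

  f≢0 : ∀ i → f i ≢ 0
  f≢0 i f≡0 = 1+n≰n (subst (1 ≤_) f≡0 (proj₁ (vlabel-range i)))

  label-bounds : ∀ s → 1 ≤ g s × g s ≤ 2 * k + 1
  label-bounds (inj₁ i) = 2*-bounds (proj₁ (vlabel-range i)) (proj₂ (vlabel-range i))
  label-bounds (inj₂ i) = 1+2*-bounds (proj₂ (vlabel-range i))

  edge-label-bounds : ∀ s t → CloneAdj G s t →
                      1 ≤ ∣ g s - g t ∣ × ∣ g s - g t ∣ ≤ 2 * k + 1
  edge-label-bounds (inj₁ i) (inj₁ j) i~j rewrite ∣2m-2n∣≡2∣m-n∣ (f i) (f j) =
    2*-bounds (proj₁ (elabel-range i j i~j)) (proj₂ (elabel-range i j i~j))
  edge-label-bounds (inj₂ i) (inj₂ j) i~j rewrite ∣2m-2n∣≡2∣m-n∣ (f i) (f j) =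
    2*-bounds (proj₁ (elabel-range i j i~j)) (proj₂ (elabel-range i j i~j))
  edge-label-bounds (inj₁ i) (inj₂ .i) refl rewrite ∣n-1+n∣≡1 (2 * f i) =
    s≤s z≤n , m≤n+m 1 (2 * k)
  edge-label-bounds (inj₂ i) (inj₁ .i) refl rewrite ∣1+n-n∣≡1 (2 * f i) =
    s≤s z≤n , m≤n+m 1 (2 * k)

  adjacent-distinct : ∀ s t → CloneAdj G s t → g s ≢ g t
  adjacent-distinct (inj₁ i) (inj₁ j) i~j eq =
    adj-distinct i j i~j (*-cancelˡ-≡ (f i) (f j) 2 eq)
  adjacent-distinct (inj₂ i) (inj₂ j) i~j eq =
    adj-distinct i j i~j (*-cancelˡ-≡ (f i) (f j) 2 (suc-injective eq))
  adjacent-distinct (inj₁ i) (inj₂ .i) refl eq = even≢odd (f i) (f i) eq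
  adjacent-distinct (inj₂ i) (inj₁ .i) refl eq = even≢odd (f i) (f i) (sym eq)

  edge-label≢endpoint : ∀ s t → CloneAdj G s t → ∣ g s - g t ∣ ≢ g s
  edge-label≢endpoint (inj₁ i) (inj₁ j) i~j eq =
    edge-endpoint i j i~j
      (*-cancelˡ-≡ ∣ f i - f j ∣ (f i) 2 (trans (sym (∣2m-2n∣≡2∣m-n∣ (f i) (f j))) eq))
  edge-label≢endpoint (inj₂ i) (inj₂ j) i~j eq =
    even≢odd ∣ f i - f j ∣ (f i) (trans (sym (∣2m-2n∣≡2∣m-n∣ (f i) (f j))) eq)
  edge-label≢endpoint (inj₁ i) (inj₂ .i) refl eq =
    even≢odd (f i) 0 (trans (sym eq) (∣n-1+n∣≡1 (2 * f i)))
  edge-label≢endpoint (inj₂ i) (inj₁ .i) refl eq =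
    f≢0 i (*-cancelˡ-≡ (f i) 0 2 (suc-injective (trans (sym eq) (∣1+n-n∣≡1 (2 * f i)))))

  incident-edges-distinct : ∀ s t u → CloneAdj G s t → CloneAdj G s u → t ≢ u →
                            ∣ g s - g t ∣ ≢ ∣ g s - g u ∣
  incident-edges-distinct (inj₁ i) (inj₁ j) (inj₁ l) i~j i~l j≢l eq =
    edge-distinct i j l i~j i~l (λ j≡l → j≢l (cong inj₁ j≡l))
      (∣2m-2n∣≡∣2m-2o∣⇒∣m-n∣≡∣m-o∣ (f i) (f j) (f l) eq)
  incident-edges-distinct (inj₂ i) (inj₂ j) (inj₂ l) i~j i~l j≢l eq =
    edge-distinct i j l i~j i~l (λ j≡l → j≢l (cong inj₂ j≡l))
      (∣2m-2n∣≡∣2m-2o∣⇒∣m-n∣≡∣m-o∣ (f i) (f j) (f l) eq)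
  incident-edges-distinct (inj₁ i) (inj₁ j) (inj₂ .i) _ refl _ eq =
    ∣2m-2n∣≢1 (f i) (f j) (trans eq (∣n-1+n∣≡1 (2 * f i)))
  incident-edges-distinct (inj₂ i) (inj₂ j) (inj₁ .i) _ refl _ eq =
    ∣2m-2n∣≢1 (f i) (f j) (trans eq (∣1+n-n∣≡1 (2 * f i)))
  incident-edges-distinct (inj₁ i) (inj₂ .i) (inj₁ l) refl _ _ eq =
    ∣2m-2n∣≢1 (f i) (f l) (trans (sym eq) (∣n-1+n∣≡1 (2 * f i)))
  incident-edges-distinct (inj₂ i) (inj₁ .i) (inj₂ l) refl _ _ eq =
    ∣2m-2n∣≢1 (f i) (f l) (trans (sym eq) (∣1+n-n∣≡1 (2 * f i)))
  incident-edges-distinct (inj₁ i) (inj₂ .i) (inj₂ .i) refl refl i≢i _ = i≢i refl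
  incident-edges-distinct (inj₂ i) (inj₁ .i) (inj₁ .i) refl refl i≢i _ = i≢i refl

  cloneTDL : ProperTDL (clone G) (2 * k + 1)
  cloneTDL = record
    { f             = λ u → g (splitAt N u)
    ; vlabel-range  = λ u → label-bounds (splitAt N u)
    ; elabel-range  = λ u v → edge-label-bounds (splitAt N u) (splitAt N v)
    ; adj-distinct  = λ u v → adjacent-distinct (splitAt N u) (splitAt N v)
    ; edge-distinct = λ u v w u~v u~w v≢w →
        incident-edges-distinct (splitAt N u) (splitAt N v) (splitAt N w) u~v u~w
          (λ eq → v≢w (splitAt-injective N eq))
    ; edge-endpoint = λ u v → edge-label≢endpoint (splitAt N u) (splitAt N v)
    }
    where N = n G

mainTheorem8 : (G : Graph) (k m : ℕ) → IsChiTd G k → IsChiTd (clone G) m →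
               m ≤ 2 * k + 1
mainTheorem8 G k m (_ , P , _) χ-clone =
  IsChiTd⇒≤ χ-clone (m≤n+m 1 (2 * k)) (CloneLabelling.cloneTDL G k P)
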